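{- Let $G$ be a controllable simple graph on $n$ vertices with adjacency matrix $A$ and walk matrix $W=W(G)$, let $p$ be an odd prime factor of $\det W$ with $\operatorname{rank}_p W=n-1$, and let $\tau=v_p(L(G))\ge 1$. Let $z_0$ be an integral vector with $z_0\not\equiv 0\pmod p$ and $\lambda_0$ an integer such that $z_0^{\mathsf T}z_0\equiv 0$, $z_0^{\mathsf T}Az_0\equiv 0\pmod{p^{2\tau}}$, $W^{\mathsf T}z_0\equiv 0\pmod{p^\tau}$ and $Az_0\equiv\lambda_0z_0\pmod{p^\tau}$. If $y$ is an integral vector such that $(A-\lambda_0 I)y\equiv s p^j z_0\pmod{p^{j+\tau}}$ for some integer $s$ and some integer $j\ge 0$, then $$W^{\mathsf T}y\equiv (e^{\mathsf T}y)\,(1,\lambda_0,\ldots,\lambda_0^{n-1})^{\mathsf T}\pmod{p^{j+\tau}}.$$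
   Context: $W(G)=[e,Ae,\ldots,A^{n-1}e]$ with $e$ the all-ones vector; $G$ is controllable if $\det W(G)\ne0$. $\operatorname{rank}_p$ is rank over $\mathbb{Z}/p\mathbb{Z}$. $v_p(m)$ is the largest $s\ge0$ with $p^s\mid m$. $\mathcal{Q}(G)$ is the set of rational orthogonal $n\times n$ matrices $Q$ with all row sums $1$ such that $Q^{\mathsf T}AQ$ is a $(0,1)$-matrix; $\ell(Q)$ is the least positive integer $k$ with $kQ$ integral; $L(G)=\operatorname{lcm}\{\ell(Q):Q\in\mathcal{Q}(G)\}$. Vector congruences are entrywise. -}

module Defs where

open import Data.Nat as ℕ using (ℕ; zero; suc)
open import Data.Nat.Primality using (Prime)
open import Data.Integer as ℤ using (ℤ; +_; -_; _-_)
open import Data.Integer.Divisibility as ℤD using ()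
open import Data.Rational as ℚ using (ℚ; _/_; 0ℚ; 1ℚ)
open import Data.Fin using (Fin; zero; suc; toℕ; punchIn; _≟_)
open import Data.Fin.Subset using (Subset; _∈_; ∣_∣)
open import Data.Vec using (lookup)
open import Data.Nat.Divisibility as ℕD using ()
open import Data.Bool using (Bool; true; false; if_then_else_)
open import Data.Product using (_×_; Σ; ∃)
open import Data.Sum using (_⊎_)
open import Relation.Nullary using (¬_; yes; no)
open import Relation.Binary.PropositionalEquality using (_≡_)

Σℤ : ∀ {n} → (Fin n → ℤ) → ℤ
Σℤ {zero}  f = + 0
Σℤ {suc n} f = f zero ℤ.+ Σℤ (λ i → f (suc i))

Σℚ : ∀ {n} → (Fin n → ℚ) → ℚ
Σℚ {zero}  f = 0ℚ
Σℚ {suc n} f = f zero ℚ.+ Σℚ (λ i → f (suc i))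

Vecℤ : ℕ → Set
Vecℤ n = Fin n → ℤ

Matℤ : ℕ → Set
Matℤ n = Fin n → Fin n → ℤ

_·_ : ∀ {n} → Matℤ n → Vecℤ n → Vecℤ n
(M · v) i = Σℤ (λ k → M i k ℤ.* v k)

_ᵀ·_ : ∀ {n} → Matℤ n → Vecℤ n → Vecℤ n
(M ᵀ· v) i = Σℤ (λ k → M k i ℤ.* v k)

dot : ∀ {n} → Vecℤ n → Vecℤ n → ℤ
dot u v = Σℤ (λ k → u k ℤ.* v k)

ones : ∀ {n} → Vecℤ n
ones _ = + 1

Iℤ : ∀ {n} → Matℤ n
Iℤ i j with i ≟ j
... | yes _ = + 1
... | no  _ = + 0

det : ∀ {n} → Matℤ n → ℤ
det {zero}  M = + 1
det {suc n} M =
  Σℤ (λ j → ((- + 1) ℤ.^ toℕ j) ℤ.* M zero j ℤ.* det (λ r c → M (suc r) (punchIn j c)))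

record Graph (n : ℕ) : Set where
  field
    adj       : Fin n → Fin n → Bool
    symmetric : ∀ i j → adj i j ≡ adj j i
    loopless  : ∀ i → adj i i ≡ false

adjMat : ∀ {n} → Graph n → Matℤ n
adjMat G i j = if Graph.adj G i j then + 1 else + 0

walkVec : ∀ {n} → Graph n → ℕ → Vecℤ n
walkVec G zero    = ones
walkVec G (suc k) = adjMat G · walkVec G k

-- W(G) = [e, Ae, …, A^{n-1}e]; entry (i,k) is (A^k e)_i
walkMat : ∀ {n} → Graph n → Matℤ n
walkMat G i k = walkVec G (toℕ k) i

Controllable : ∀ {n} → Graph n → Set
Controllable G = ¬ (det (walkMat G) ≡ + 0)

_≡_[mod_] : ℤ → ℤ → ℤ → Set
x ≡ y [mod m ] = m ℤD.∣ (x - y)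

_≡ᵥ_[mod_] : ∀ {n} → Vecℤ n → Vecℤ n → ℤ → Set
u ≡ᵥ v [mod m ] = ∀ i → u i ≡ v i [mod m ]

-- Rank over ℤ/pℤ (column rank: maximal size of a set of columns that
-- is linearly independent modulo p)

IndepMod : ∀ {n} → ℕ → Matℤ n → Subset n → Set
IndepMod {n} p M S =
  ∀ (c : Vecℤ n) →
    (∀ i → Σℤ (λ j → if lookup S j then c j ℤ.* M i j else + 0) ≡ + 0 [mod + p ]) →
    ∀ j → j ∈ S → c j ≡ + 0 [mod + p ]

RankMod : ∀ {n} → ℕ → Matℤ n → ℕ → Set
RankMod {n} p M r =
  (Σ (Subset n) λ S → ∣ S ∣ ≡ r × IndepMod p M S) ×
  (∀ (S : Subset n) → IndepMod p M S → ∣ S ∣ ℕ.≤ r)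

Valuation : ℕ → ℕ → ℕ → Set
Valuation p m s = (p ℕ.^ s) ℕD.∣ m × ¬ ((p ℕ.^ suc s) ℕD.∣ m)

Matℚ : ℕ → Set
Matℚ n = Fin n → Fin n → ℚ

toℚ : ℤ → ℚ
toℚ z = z / 1

δℚ : ∀ {n} → Fin n → Fin n → ℚ
δℚ i j with i ≟ j
... | yes _ = 1ℚ
... | no  _ = 0ℚ

InQ : ∀ {n} → Graph n → Matℚ n → Set
InQ G Q =
  (∀ i j → Σℚ (λ k → Q k i ℚ.* Q k j) ≡ δℚ i j) ×
  (∀ i → Σℚ (λ j → Q i j) ≡ 1ℚ) ×
  (∀ i j → let x = Σℚ (λ k → Σℚ (λ l → Q k i ℚ.* toℚ (adjMat G k l) ℚ.* Q l j))
           in x ≡ 0ℚ ⊎ x ≡ 1ℚ)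

IntegralMultiple : ∀ {n} → ℕ → Matℚ n → Set
IntegralMultiple k Q = ∀ i j → Σ ℤ λ z → toℚ (+ k) ℚ.* Q i j ≡ toℚ z

IsLevel : ∀ {n} → Matℚ n → ℕ → Set
IsLevel Q k =
  1 ℕ.≤ k × IntegralMultiple k Q ×
  (∀ k′ → 1 ℕ.≤ k′ → IntegralMultiple k′ Q → k ℕ.≤ k′)

IsLG : ∀ {n} → Graph n → ℕ → Set
IsLG G L =
  (∀ Q k → InQ G Q → IsLevel Q k → k ℕD.∣ L) ×
  (∀ M → (∀ Q k → InQ G Q → IsLevel Q k → k ℕD.∣ M) → L ℕD.∣ M)

-- Put d m = (Aᵐ e)ᵀ y. As A is symmetric, d (m+1) − λ₀ d m = (Aᵐ e)ᵀ (A − λ₀ I) y,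
-- which is s pʲ (Aᵐ e)ᵀ z₀ modulo p^(j+τ); for m < n, (Aᵐ e)ᵀ z₀ is an entry of Wᵀ z₀ and
-- hence divisible by p^τ. So d (m+1) ≡ λ₀ d m and by induction d m ≡ λ₀ᵐ d 0 = λ₀ᵐ eᵀ y.
-- Only the symmetry of A and the congruences for Wᵀ z₀ and (A − λ₀ I) y are needed; the
-- remaining hypotheses of the statement are unused.

module Submission where

open import Defs
open import Data.Nat as ℕ using (ℕ; _+_; _*_; _∸_)
open import Data.Nat.Primality using (Prime)
open import Data.Integer as ℤ using (ℤ; +_)
open import Data.Integer.Divisibility as ℤD using ()
open import Data.Fin using (Fin; toℕ)
open import Relation.Nullary using (¬_)
open import Relation.Binary.PropositionalEquality using (_≡_)

open import Data.Nat.Properties as ℕP using ()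
open import Data.Integer.Properties as ℤP using ()
open import Data.Integer.Divisibility.Signed as S using (divides)
open import Data.Integer.Tactic.RingSolver using (solve-∀)
open import Data.Fin as F using (zero; suc; fromℕ<)
open import Data.Fin.Properties as FP using ()
open import Data.Integer using (_-_; -_)
open import Data.Bool using (if_then_else_)
open import Relation.Nullary using (yes; no)
open import Relation.Binary.Structures using (IsPreorder)
import Relation.Binary.Reasoning.Base.Double
open import Relation.Binary.PropositionalEquality
  using (refl; sym; trans; cong; cong₂; subst; isEquivalence; module ≡-Reasoning)
open import Algebra.Properties.Semiring.Sum ℤP.+-*-semiring
  using (sum; sum-cong-≗; sum-replicate-zero; ∑-distrib-+; ∑-comm; *-distribˡ-sum)

Σℤ≗sum : ∀ {n} (f : Fin n → ℤ) → Σℤ f ≡ sum f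
Σℤ≗sum {ℕ.zero}  f = refl
Σℤ≗sum {ℕ.suc n} f = cong (ℤ._+_ (f zero)) (Σℤ≗sum (λ i → f (suc i)))

Σℤ-cong : ∀ {n} {f g : Fin n → ℤ} → (∀ i → f i ≡ g i) → Σℤ f ≡ Σℤ g
Σℤ-cong {f = f} {g} f≗g = trans (Σℤ≗sum f) (trans (sum-cong-≗ f≗g) (sym (Σℤ≗sum g)))

Σℤ-zero : ∀ n → Σℤ {n} (λ _ → + 0) ≡ + 0
Σℤ-zero n = trans (Σℤ≗sum {n} (λ _ → + 0)) (sum-replicate-zero n)

Σℤ-comm : ∀ {m n} (f : Fin m → Fin n → ℤ) →
          Σℤ (λ i → Σℤ (f i)) ≡ Σℤ (λ j → Σℤ (λ i → f i j))
Σℤ-comm f = begin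
  Σℤ (λ i → Σℤ (f i))            ≡⟨ Σℤ-cong (λ i → Σℤ≗sum (f i)) ⟩
  Σℤ (λ i → sum (f i))           ≡⟨ Σℤ≗sum (λ i → sum (f i)) ⟩
  sum (λ i → sum (f i))          ≡⟨ ∑-comm f ⟩
  sum (λ j → sum (λ i → f i j))  ≡⟨ Σℤ≗sum (λ j → sum (λ i → f i j)) ⟨
  Σℤ (λ j → sum (λ i → f i j))   ≡⟨ Σℤ-cong (λ j → Σℤ≗sum (λ i → f i j)) ⟨
  Σℤ (λ j → Σℤ (λ i → f i j))    ∎
  where open ≡-Reasoning

Σℤ-*ˡ : ∀ {n} (c : ℤ) (f : Fin n → ℤ) → Σℤ (λ i → c ℤ.* f i) ≡ c ℤ.* Σℤ f
Σℤ-*ˡ c f = begin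
  Σℤ (λ i → c ℤ.* f i)   ≡⟨ Σℤ≗sum (λ i → c ℤ.* f i) ⟩
  sum (λ i → c ℤ.* f i)  ≡⟨ *-distribˡ-sum c f ⟨
  c ℤ.* sum f            ≡⟨ cong (ℤ._*_ c) (Σℤ≗sum f) ⟨
  c ℤ.* Σℤ f             ∎
  where open ≡-Reasoning

Σℤ-linear : ∀ {n} (c : ℤ) (f g : Fin n → ℤ) →
            Σℤ (λ i → f i - c ℤ.* g i) ≡ Σℤ f - c ℤ.* Σℤ g
Σℤ-linear c f g = begin
  Σℤ (λ i → f i - c ℤ.* g i)          ≡⟨ Σℤ-cong (λ i → cong (ℤ._+_ (f i)) (ℤP.neg-distribˡ-* c (g i))) ⟩
  Σℤ (λ i → f i ℤ.+ (- c) ℤ.* g i)    ≡⟨ Σℤ≗sum (λ i → f i ℤ.+ (- c) ℤ.* g i) ⟩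
  sum (λ i → f i ℤ.+ (- c) ℤ.* g i)   ≡⟨ ∑-distrib-+ f (λ i → (- c) ℤ.* g i) ⟩
  sum f ℤ.+ sum (λ i → (- c) ℤ.* g i) ≡⟨ cong₂ ℤ._+_ (Σℤ≗sum f) (Σℤ≗sum (λ i → (- c) ℤ.* g i)) ⟨
  Σℤ f ℤ.+ Σℤ (λ i → (- c) ℤ.* g i)   ≡⟨ cong (ℤ._+_ (Σℤ f)) (Σℤ-*ˡ (- c) g) ⟩
  Σℤ f ℤ.+ (- c) ℤ.* Σℤ g             ≡⟨ cong (ℤ._+_ (Σℤ f)) (ℤP.neg-distribˡ-* c (Σℤ g)) ⟨
  Σℤ f - c ℤ.* Σℤ g                   ∎
  where open ≡-Reasoning

Σℤ-divisible : ∀ {n} {k : ℤ} (f : Fin n → ℤ) → (∀ i → k S.∣ f i) → k S.∣ Σℤ f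
Σℤ-divisible {ℕ.zero}  f k∣f = divides (+ 0) refl
Σℤ-divisible {ℕ.suc n} f k∣f =
  S.∣m∣n⇒∣m+n (k∣f zero) (Σℤ-divisible (λ i → f (suc i)) (λ i → k∣f (suc i)))

Iℤ-suc : ∀ {n} (i k : Fin n) → Iℤ (suc i) (suc k) ≡ Iℤ i k
Iℤ-suc i k with i F.≟ k
... | yes _ = refl
... | no  _ = refl

Σℤ-Iℤ : ∀ {n} (i : Fin n) (v : Vecℤ n) → Σℤ (λ k → Iℤ i k ℤ.* v k) ≡ v i
Σℤ-Iℤ {ℕ.suc n} zero v = begin
  + 1 ℤ.* v zero ℤ.+ Σℤ {n} (λ _ → + 0)  ≡⟨ cong₂ ℤ._+_ (ℤP.*-identityˡ (v zero)) (Σℤ-zero n) ⟩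
  v zero ℤ.+ + 0                         ≡⟨ ℤP.+-identityʳ (v zero) ⟩
  v zero                                 ∎
  where open ≡-Reasoning
Σℤ-Iℤ {ℕ.suc n} (suc i) v = begin
  + 0 ℤ.+ Σℤ (λ k → Iℤ (suc i) (suc k) ℤ.* v (suc k))  ≡⟨ ℤP.+-identityˡ _ ⟩
  Σℤ (λ k → Iℤ (suc i) (suc k) ℤ.* v (suc k))        ≡⟨ Σℤ-cong (λ k → cong (λ x → x ℤ.* v (suc k)) (Iℤ-suc i k)) ⟩
  Σℤ (λ k → Iℤ i k ℤ.* v (suc k))                    ≡⟨ Σℤ-Iℤ i (λ k → v (suc k)) ⟩
  v (suc i)                                          ∎
  where open ≡-Reasoning

dot-ᵀ· : ∀ {n} (M : Matℤ n) (u v : Vecℤ n) → dot u (M · v) ≡ dot (M ᵀ· u) v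
dot-ᵀ· M u v = begin
  Σℤ (λ l → u l ℤ.* Σℤ (λ i → M l i ℤ.* v i))        ≡⟨ Σℤ-cong (λ l → Σℤ-*ˡ (u l) (λ i → M l i ℤ.* v i)) ⟨
  Σℤ (λ l → Σℤ (λ i → u l ℤ.* (M l i ℤ.* v i)))      ≡⟨ Σℤ-comm (λ l i → u l ℤ.* (M l i ℤ.* v i)) ⟩
  Σℤ (λ i → Σℤ (λ l → u l ℤ.* (M l i ℤ.* v i)))      ≡⟨ Σℤ-cong (λ i → Σℤ-cong (λ l → regroup (u l) (M l i) (v i))) ⟩
  Σℤ (λ i → Σℤ (λ l → v i ℤ.* (M l i ℤ.* u l)))      ≡⟨ Σℤ-cong (λ i → Σℤ-*ˡ (v i) (λ l → M l i ℤ.* u l)) ⟩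
  Σℤ (λ i → v i ℤ.* Σℤ (λ l → M l i ℤ.* u l))        ≡⟨ Σℤ-cong (λ i → ℤP.*-comm (v i) _) ⟩
  Σℤ (λ i → Σℤ (λ l → M l i ℤ.* u l) ℤ.* v i)        ∎
  where
  open ≡-Reasoning
  regroup : ∀ a m b → a ℤ.* (m ℤ.* b) ≡ b ℤ.* (m ℤ.* a)
  regroup = solve-∀

dot-·-symmetric : ∀ {n} (M : Matℤ n) → (∀ a b → M a b ≡ M b a) →
                  ∀ (u v : Vecℤ n) → dot (M · u) v ≡ dot u (M · v)
dot-·-symmetric M M-sym u v = trans
  (Σℤ-cong (λ i → cong (λ x → x ℤ.* v i) (Σℤ-cong (λ k → cong (λ x → x ℤ.* u k) (M-sym i k)))))
  (sym (dot-ᵀ· M u v))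

dot-linearʳ : ∀ {n} (c : ℤ) (w u v : Vecℤ n) →
              dot w (λ i → u i - c ℤ.* v i) ≡ dot w u - c ℤ.* dot w v
dot-linearʳ c w u v = trans
  (Σℤ-cong (λ i → distrib (w i) (u i) c (v i)))
  (Σℤ-linear c (λ i → w i ℤ.* u i) (λ i → w i ℤ.* v i))
  where
  distrib : ∀ a x c y → a ℤ.* (x - c ℤ.* y) ≡ a ℤ.* x - c ℤ.* (a ℤ.* y)
  distrib = solve-∀

·-minus-scaled-identity : ∀ {n} (M : Matℤ n) (c : ℤ) (v : Vecℤ n) (i : Fin n) →
  ((λ a b → M a b - c ℤ.* Iℤ a b) · v) i ≡ (M · v) i - c ℤ.* v i
·-minus-scaled-identity M c v i = begin
  Σℤ (λ k → (M i k - c ℤ.* Iℤ i k) ℤ.* v k)            ≡⟨ Σℤ-cong (λ k → distrib (M i k) c (Iℤ i k) (v k)) ⟩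
  Σℤ (λ k → M i k ℤ.* v k - c ℤ.* (Iℤ i k ℤ.* v k))    ≡⟨ Σℤ-linear c (λ k → M i k ℤ.* v k) (λ k → Iℤ i k ℤ.* v k) ⟩
  (M · v) i - c ℤ.* Σℤ (λ k → Iℤ i k ℤ.* v k)          ≡⟨ cong (λ x → (M · v) i - c ℤ.* x) (Σℤ-Iℤ i v) ⟩
  (M · v) i - c ℤ.* v i                                ∎
  where
  open ≡-Reasoning
  distrib : ∀ m c e x → (m - c ℤ.* e) ℤ.* x ≡ m ℤ.* x - c ℤ.* (e ℤ.* x)
  distrib = solve-∀

-- x ≡ y [mod k ] unfolds to a divisibility of absolute values, from which Agda cannot
-- recover k, x or y: they are passed explicitly throughout.
≡-mod-reflexive : ∀ {k x y : ℤ} → x ≡ y → x ≡ y [mod k ]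
≡-mod-reflexive {k} {x} refl = S.∣⇒∣ᵤ {k} (divides (+ 0) (ℤP.+-inverseʳ x))

≡-mod-trans : ∀ {k x y z : ℤ} → x ≡ y [mod k ] → y ≡ z [mod k ] → x ≡ z [mod k ]
≡-mod-trans {k} {x} {y} {z} x≡y y≡z =
  S.∣⇒∣ᵤ {k} (subst (k S.∣_) (ℤP.+-minus-telescope x y z)
    (S.∣m∣n⇒∣m+n (S.∣ᵤ⇒∣ {k} {x - y} x≡y) (S.∣ᵤ⇒∣ {k} {y - z} y≡z)))

≡-mod-*-congˡ : ∀ {k x y : ℤ} (c : ℤ) → x ≡ y [mod k ] → (c ℤ.* x) ≡ (c ℤ.* y) [mod k ]
≡-mod-*-congˡ {k} {x} {y} c x≡y =
  S.∣⇒∣ᵤ {k} (subst (k S.∣_) (distrib c x y) (S.∣n⇒∣m*n c (S.∣ᵤ⇒∣ {k} {x - y} x≡y)))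
  where
  distrib : ∀ c x y → c ℤ.* (x - y) ≡ c ℤ.* x - c ℤ.* y
  distrib = solve-∀

dot-congʳ-mod : ∀ {n} {k c : ℤ} (w u v : Vecℤ n) → u ≡ᵥ (λ i → c ℤ.* v i) [mod k ] →
                dot w u ≡ (c ℤ.* dot w v) [mod k ]
dot-congʳ-mod {k = k} {c} w u v u≡cv =
  S.∣⇒∣ᵤ {k} (subst (k S.∣_) (dot-linearʳ c w u v) (Σℤ-divisible _ k∣w[u-cv]))
  where
  k∣w[u-cv] : ∀ i → k S.∣ w i ℤ.* (u i - c ℤ.* v i)
  k∣w[u-cv] i = S.∣n⇒∣m*n (w i) (S.∣ᵤ⇒∣ {k} {u i - c ℤ.* v i} (u≡cv i))

≡-mod-isPreorder : (k : ℤ) → IsPreorder _≡_ (λ x y → x ≡ y [mod k ])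
≡-mod-isPreorder k = record
  { isEquivalence = isEquivalence
  ; reflexive     = λ {x} {y} → ≡-mod-reflexive {k} {x} {y}
  ; trans         = λ {x} {y} {z} → ≡-mod-trans {k} {x} {y} {z}
  }

module ≡-mod-Reasoning (k : ℤ) = Relation.Binary.Reasoning.Base.Double (≡-mod-isPreorder k)

geometric-congruence : ∀ (d : ℕ → ℤ) (λ₀ k : ℤ) (n : ℕ) →
  (∀ m → m ℕ.< n → d (ℕ.suc m) ≡ (λ₀ ℤ.* d m) [mod k ]) →
  ∀ m → m ℕ.≤ n → d m ≡ (d 0 ℤ.* λ₀ ℤ.^ m) [mod k ]
geometric-congruence d λ₀ k n step ℕ.zero    _   = ≡-mod-reflexive {k} (sym (ℤP.*-identityʳ (d 0)))
geometric-congruence d λ₀ k n step (ℕ.suc m) m<n = begin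
  d (ℕ.suc m)                      ≲⟨ step m m<n ⟩
  λ₀ ℤ.* d m                       ≲⟨ ≡-mod-*-congˡ {k} {d m} {d 0 ℤ.* λ₀ ℤ.^ m} λ₀ closed-form ⟩
  λ₀ ℤ.* (d 0 ℤ.* λ₀ ℤ.^ m)        ≡⟨ swap λ₀ (d 0) (λ₀ ℤ.^ m) ⟩
  d 0 ℤ.* λ₀ ℤ.^ ℕ.suc m           ∎
  where
  open ≡-mod-Reasoning k
  closed-form : d m ≡ (d 0 ℤ.* λ₀ ℤ.^ m) [mod k ]
  closed-form = geometric-congruence d λ₀ k n step m (ℕP.<⇒≤ m<n)
  swap : ∀ a b c → a ℤ.* (b ℤ.* c) ≡ b ℤ.* (a ℤ.* c)
  swap = solve-∀

dot-·-minus-scaled-identity : ∀ {n} (A : Matℤ n) → (∀ u v → A u v ≡ A v u) →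
  ∀ (λ₀ : ℤ) (w y : Vecℤ n) →
  dot w ((λ u v → A u v - λ₀ ℤ.* Iℤ u v) · y) ≡ dot (A · w) y - λ₀ ℤ.* dot w y
dot-·-minus-scaled-identity A A-sym λ₀ w y = begin
  dot w ((λ u v → A u v - λ₀ ℤ.* Iℤ u v) · y)  ≡⟨ Σℤ-cong (λ i → cong (w i ℤ.*_) (·-minus-scaled-identity A λ₀ y i)) ⟩
  dot w (λ i → (A · y) i - λ₀ ℤ.* y i)         ≡⟨ dot-linearʳ λ₀ w (A · y) y ⟩
  dot w (A · y) - λ₀ ℤ.* dot w y               ≡⟨ cong (λ x → x - λ₀ ℤ.* dot w y) (dot-·-symmetric A A-sym w y) ⟨
  dot (A · w) y - λ₀ ℤ.* dot w y               ∎
  where open ≡-Reasoning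

dot-·-eigenvalue-congruence :
  ∀ {n} (A : Matℤ n) → (∀ u v → A u v ≡ A v u) →
  ∀ (λ₀ s a b k : ℤ) → k ≡ a ℤ.* b → ∀ (y z w : Vecℤ n) →
  ((λ u v → A u v - λ₀ ℤ.* Iℤ u v) · y) ≡ᵥ (λ i → s ℤ.* a ℤ.* z i) [mod k ] →
  dot w z ≡ + 0 [mod b ] →
  dot (A · w) y ≡ (λ₀ ℤ.* dot w y) [mod k ]
dot-·-eigenvalue-congruence A A-sym λ₀ s a b _ refl y z w By≡saz wz≡0 =
  S.∣⇒∣ᵤ {a ℤ.* b} (subst (a ℤ.* b S.∣_) shift (S.∣m∣n⇒∣m+n ab∣wBy-saWz ab∣saWz))
  where
  B : Matℤ _
  B u v = A u v - λ₀ ℤ.* Iℤ u v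
  saWz : ℤ
  saWz = s ℤ.* a ℤ.* dot w z
  ab∣wBy-saWz : a ℤ.* b S.∣ dot w (B · y) - saWz
  ab∣wBy-saWz = S.∣ᵤ⇒∣ {a ℤ.* b} {dot w (B · y) - saWz}
    (dot-congʳ-mod {k = a ℤ.* b} {s ℤ.* a} w (B · y) z By≡saz)
  b∣wz : b S.∣ dot w z
  b∣wz = subst (b S.∣_) (ℤP.+-identityʳ (dot w z)) (S.∣ᵤ⇒∣ {b} {dot w z - + 0} wz≡0)
  ab∣saWz : a ℤ.* b S.∣ saWz
  ab∣saWz = subst (a ℤ.* b S.∣_) (sym (ℤP.*-assoc s a (dot w z))) (S.∣n⇒∣m*n s (S.*-monoʳ-∣ a b∣wz))
  cancel : ∀ x c → (x - c) ℤ.+ c ≡ x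
  cancel = solve-∀
  shift : (dot w (B · y) - saWz) ℤ.+ saWz ≡ dot (A · w) y - λ₀ ℤ.* dot w y
  shift = trans (cancel (dot w (B · y)) saWz) (dot-·-minus-scaled-identity A A-sym λ₀ w y)

adjMat-symmetric : ∀ {n} (G : Graph n) (u v : Fin n) → adjMat G u v ≡ adjMat G v u
adjMat-symmetric G u v = cong (λ e → if e then + 1 else + 0) (Graph.symmetric G u v)

lemma3p3 : ∀ {n} (G : Graph n) → Controllable G →
    ∀ (p : ℕ) → Prime p → ¬ (p ≡ 2) →
    (+ p) ℤD.∣ det (walkMat G) →
    RankMod p (walkMat G) (n ∸ 1) →
    ∀ (τ L : ℕ) → IsLG G L → Valuation p L τ → 1 ℕ.≤ τ →
    ∀ (z₀ : Vecℤ n) (λ₀ : ℤ) →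
    ¬ (z₀ ≡ᵥ (λ _ → + 0) [mod + p ]) →
    dot z₀ z₀ ≡ + 0 [mod + (p ℕ.^ (2 * τ)) ] →
    dot z₀ (adjMat G · z₀) ≡ + 0 [mod + (p ℕ.^ (2 * τ)) ] →
    (walkMat G ᵀ· z₀) ≡ᵥ (λ _ → + 0) [mod + (p ℕ.^ τ) ] →
    (adjMat G · z₀) ≡ᵥ (λ i → λ₀ ℤ.* z₀ i) [mod + (p ℕ.^ τ) ] →
    ∀ (y : Vecℤ n) (s : ℤ) (j : ℕ) →
    ((λ a b → adjMat G a b ℤ.- λ₀ ℤ.* Iℤ a b) · y)
      ≡ᵥ (λ i → s ℤ.* + (p ℕ.^ j) ℤ.* z₀ i) [mod + (p ℕ.^ (j + τ)) ] →
    (walkMat G ᵀ· y)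
      ≡ᵥ (λ k → dot ones y ℤ.* (λ₀ ℤ.^ toℕ k)) [mod + (p ℕ.^ (j + τ)) ]
lemma3p3 {n} G _ p _ _ _ _ τ _ _ _ _ z₀ λ₀ _ _ _ Wᵀz₀≡0 _ y s j By≡spz k =
  geometric-congruence d λ₀ (+ (p ℕ.^ (j + τ))) n step (toℕ k) (ℕP.<⇒≤ (FP.toℕ<n k))
  where
  d : ℕ → ℤ
  d m = dot (walkVec G m) y
  modulus : + (p ℕ.^ (j + τ)) ≡ + (p ℕ.^ j) ℤ.* + (p ℕ.^ τ)
  modulus = trans (cong +_ (ℕP.^-distribˡ-+-* p j τ)) (ℤP.pos-* (p ℕ.^ j) (p ℕ.^ τ))
  walk-orthogonal : ∀ m → m ℕ.< n → dot (walkVec G m) z₀ ≡ + 0 [mod + (p ℕ.^ τ) ]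
  walk-orthogonal m m<n = subst (λ i → dot (walkVec G i) z₀ ≡ + 0 [mod + (p ℕ.^ τ) ])
    (FP.toℕ-fromℕ< m<n) (Wᵀz₀≡0 (fromℕ< m<n))
  step : ∀ m → m ℕ.< n → d (ℕ.suc m) ≡ (λ₀ ℤ.* d m) [mod + (p ℕ.^ (j + τ)) ]
  step m m<n = dot-·-eigenvalue-congruence (adjMat G) (adjMat-symmetric G)
    λ₀ s (+ (p ℕ.^ j)) (+ (p ℕ.^ τ)) _ modulus y z₀ (walkVec G m) By≡spz (walk-orthogonal m m<n)
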